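{- Let $G$ be an elementary abelian $2$-group of rank $4$ and let $\mathcal{A}$ be a $2$-S-ring over $G$. Then $\mathcal{A}$ is cyclotomic.
   Context: For a finite group $G$ with identity $e$ and $X\subseteq G$ let $\underline{X}=\sum_{x\in X}x$. An S-ring over $G$ is a subring $\mathcal{A}\subseteq\mathbb{Z}G$ for which there is a partition $\mathcal{S}(\mathcal{A})$ of $G$ (basic sets) with $\{e\}\in\mathcal{S}(\mathcal{A})$, closed under inversion, and $\mathcal{A}=\mathrm{Span}_{\mathbb{Z}}\{\underline{X}:X\in\mathcal{S}(\mathcal{A})\}$. A $2$-S-ring over a $2$-group is an S-ring all of whose basic sets have $2$-power size. $\mathcal{A}$ is cyclotomic if there is a subgroup $K\le\mathrm{Aut}(G)$ such that $\mathcal{S}(\mathcal{A})$ is the set of orbits of $K$ on $G$. -}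

module Defs where

open import Data.Bool using (Bool; true; false; _xor_)
open import Data.Nat using (ℕ; zero; suc; _^_)
open import Data.Nat.Properties using () renaming (_≟_ to _≟ℕ_)
open import Data.Integer as ℤ using (ℤ)
open import Data.List using (List; []; _∷_; _++_; map; filter; length; foldr)
open import Data.Vec using (Vec; []; _∷_; zipWith; replicate)
open import Data.Product using (Σ; ∃; _×_; _,_)
open import Function using (_∘_; id)
open import Relation.Binary.PropositionalEquality using (_≡_)

-- The elementary abelian 2-group of rank 4, realised as (ℤ/2)^4 = Bool^4
-- under componentwise xor.
G : Set
G = Vec Bool 4

_·_ : G → G → G
_·_ = zipWith _xor_

e : G
e = replicate 4 false

-- inversion in G (every element is an involution)
inv : G → G
inv g = g

allVecs : (n : ℕ) → List (Vec Bool n)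
allVecs zero = [] ∷ []
allVecs (suc n) = map (false ∷_) (allVecs n) ++ map (true ∷_) (allVecs n)

allG : List G
allG = allVecs 4

ℤG : Set
ℤG = G → ℤ

_⋆_ : ℤG → ℤG → ℤG
(f ⋆ h) g = foldr ℤ._+_ (ℤ.+ 0) (map (λ a → f a ℤ.* h (inv a · g)) allG)

open import Data.Vec.Properties using (≡-dec)
open import Data.Bool.Properties using () renaming (_≟_ to _≟B_)
open import Relation.Nullary using (yes; no)

_≟G_ : (x y : G) → Relation.Nullary.Dec (x ≡ y)
_≟G_ = ≡-dec _≟B_

δe : ℤG
δe g with g ≟G e
... | yes _ = ℤ.+ 1
... | no _ = ℤ.+ 0

-- A partition of G is given by a labelling lab : G → ℕ; the basic sets are
-- the (nonempty) fibres  { y | lab y ≡ lab x }.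
-- The ℤ-span of the elements X̲ of the basic sets X: the elements
-- Σ_X c_X X̲, i.e. f with f g = c (lab g) for some coefficients c.
InSpan : (G → ℕ) → ℤG → Set
InSpan lab f = Σ (ℕ → ℤ) λ c → (g : G) → f g ≡ c (lab g)

blockSize : (G → ℕ) → G → ℕ
blockSize lab x = length (filter (λ y → lab y ≟ℕ lab x) allG)

record IsSRing (lab : G → ℕ) : Set where
  field
    singleton-e : (g : G) → lab g ≡ lab e → g ≡ e
    inv-closed  : (x : G) → Σ G λ y → (z : G) →
                    (lab z ≡ lab x → lab (inv z) ≡ lab y) ×
                    (lab z ≡ lab y → lab (inv z) ≡ lab x)
    one-mem     : InSpan lab δe
    mul-closed  : (f h : ℤG) → InSpan lab f → InSpan lab h → InSpan lab (f ⋆ h)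

record Is2SRing (lab : G → ℕ) : Set where
  field
    isSRing  : IsSRing lab
    two-pow  : (x : G) → ∃ λ k → blockSize lab x ≡ 2 ^ k

record IsAut (σ : G → G) : Set where
  field
    hom    : (a b : G) → σ (a · b) ≡ σ a · σ b
    σ⁻¹    : G → G
    left   : (x : G) → σ⁻¹ (σ x) ≡ x
    right  : (x : G) → σ (σ⁻¹ x) ≡ x

record IsAutSubgroup (K : (G → G) → Set) : Set where
  field
    auts    : (σ : G → G) → K σ → IsAut σ
    has-id  : K id
    comp    : (σ τ : G → G) → K σ → K τ → K (σ ∘ τ)
    inverse : (σ : G → G) → K σ → Σ (G → G) λ τ → K τ × ((x : G) → τ (σ x) ≡ x)

Cyclotomic : (G → ℕ) → Set₁
Cyclotomic lab = Σ ((G → G) → Set) λ K → IsAutSubgroup K ×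
  ((x y : G) → (lab x ≡ lab y → Σ (G → G) λ σ → K σ × σ x ≡ y) ×
               ((Σ (G → G) λ σ → K σ × σ x ≡ y) → lab x ≡ lab y))

-- Only two consequences of the S-ring axioms are used: {e} is a basic set, and for basic sets
-- X, Y the intersection number #{a ∈ X | a·z ∈ Y}, the coefficient of z in X̲·Y̲, depends only
-- on the basic set of z.  The 15 non-identity elements cannot all lie in basic sets of even
-- size, so some a ≠ e is a singleton basic set, and an automorphism of G moves a to E₃.  A
-- computation enumerates every partition of G with singletons {e} and {E₃}, classes of size 1,
-- 2, 4 or 8 and consistent intersection numbers, and checks that the classes of each are the
-- orbits of its stabiliser in GL(4,2) = Aut(G); this is cyclotomy, which transports back along
-- the automorphism.
module Submission where

open import Defs

open import Data.Bool using (Bool; true; false; T; T?; not; _∧_; _∨_; _xor_; if_then_else_)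
open import Data.Bool.ListAction using (all; any)
open import Data.Bool.Properties
  using (xor-assoc; xor-comm; xor-identityˡ; xor-identityʳ; xor-same; ∧-comm; T-∧; T-∨; T-≡)
open import Data.Empty using (⊥-elim)
open import Data.Integer as ℤ using (ℤ)
import Data.Integer.Properties as ℤ
open import Data.List
  using (List; []; _∷_; _++_; map; concatMap; filterᵇ; foldr; length; drop)
open import Data.List.Membership.Propositional using (_∈_; find; lose)
open import Data.List.Membership.Propositional.Properties
  using (∈-map⁺; ∈-++⁺ˡ; ∈-++⁺ʳ; ∈-filter⁺; ∈-filter⁻; ∈-concat⁺′)
open import Data.List.Membership.Propositional.Properties.WithK using (unique∧set⇒bag)
open import Data.List.Properties using (filter-≐; filter-accept; filter-reject; filter-none; length-filter; length-map)
open import Data.List.Relation.Binary.BagAndSetEquality using (∼bag⇒↭)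
open import Data.List.Relation.Binary.Permutation.Propositional using (_↭_)
open import Data.List.Relation.Binary.Permutation.Propositional.Properties using (filter-↭; ↭-length)
open import Data.List.Relation.Binary.Sublist.Propositional using (_⊆_; []; _∷_; _∷ʳ_)
open import Data.List.Relation.Binary.Sublist.Propositional.Properties using (filter-⊆)
open import Data.List.Relation.Unary.All as All using (All; []; _∷_)
open import Data.List.Relation.Unary.All.Properties using (all⁺; all⁻)
open import Data.List.Relation.Unary.Any using (here; there; any?)
open import Data.List.Relation.Unary.Any.Properties using (any⁺; any⁻; ¬Any[])
open import Data.List.Relation.Unary.Unique.DecPropositional _≟G_ using (Unique; unique?)
import Data.List.Relation.Unary.Unique.Propositional.Properties as Unique
open import Data.Nat using (ℕ; zero; suc; _+_; _^_; _≤_; _<_; _≡ᵇ_; z≤n; s≤s)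
open import Data.Nat.Divisibility using (_∣_; _∣?_; divides; ∣m∣n⇒∣m+n)
open import Data.Nat.Properties
  using ( _≟_; ≡ᵇ⇒≡; ≡⇒≡ᵇ; ≤-trans; ≤-pred; n<1+n; +-suc; +-monoˡ-≤; *-comm; suc-injective
        ; <-irrefl; ^-monoʳ-≤)
open import Data.Product using (∃-syntax; _×_; _,_; proj₁; proj₂)
open import Data.Sum using (inj₁; inj₂; [_,_])
open import Data.Unit using (tt)
open import Data.Vec as Vec using (Vec; []; _∷_; zipWith; replicate)
open import Data.Vec.Properties using (≡-dec)
open import Data.Vec.Relation.Binary.Pointwise.Inductive
  using (Pointwise-≡⇒≡; zipWith-assoc; zipWith-comm; zipWith-identityˡ; zipWith-identityʳ)
open import Function using (_∘_; id; _⇔_; mk⇔; Equivalence)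
open import Relation.Binary.PropositionalEquality
  using (_≡_; _≢_; refl; sym; trans; cong; cong₂; subst; module ≡-Reasoning)
open import Relation.Nullary using (Dec; yes; no; does; ¬_; ¬?; _×-dec_)
open import Relation.Nullary.Decidable using (isYes; toWitness; toWitnessFalse; fromWitness; _⊎-dec_)
open import Relation.Unary using (_≐_)

open Equivalence using (to; from)

private
  variable
    A B : Set
    n : ℕ

T-not : {b : Bool} → T (not b) ⇔ (¬ T b)
T-not {true}  = mk⇔ (λ ()) (λ ¬t → ¬t tt)
T-not {false} = mk⇔ (λ _ ()) (λ _ → tt)

T-injective : {a b : Bool} → (T a ⇔ T b) → a ≡ b
T-injective {false} {false} _   = refl
T-injective {false} {true}  a⇔b = ⊥-elim (from a⇔b tt)
T-injective {true}  {false} a⇔b = ⊥-elim (to a⇔b tt)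
T-injective {true}  {true}  _   = refl

not-∨ : (a b : Bool) → not (a ∨ b) ≡ not a ∧ not b
not-∨ true  b = refl
not-∨ false b = refl

·-assoc : (x y z : G) → (x · y) · z ≡ x · (y · z)
·-assoc x y z = Pointwise-≡⇒≡ (zipWith-assoc xor-assoc x y z)

·-comm : (x y : G) → x · y ≡ y · x
·-comm x y = Pointwise-≡⇒≡ (zipWith-comm xor-comm x y)

·-identityˡ : (x : G) → e · x ≡ x
·-identityˡ x = Pointwise-≡⇒≡ (zipWith-identityˡ xor-identityˡ x)

·-identityʳ : (x : G) → x · e ≡ x
·-identityʳ x = Pointwise-≡⇒≡ (zipWith-identityʳ xor-identityʳ x)

xor-self : (x : Vec Bool n) → zipWith _xor_ x x ≡ replicate n false
xor-self []      = refl
xor-self (b ∷ x) = cong₂ _∷_ (xor-same b) (xor-self x)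

·-self : (x : G) → x · x ≡ e
·-self = xor-self

·-interchange : (p q r s : G) → (p · q) · (r · s) ≡ (p · r) · (q · s)
·-interchange p q r s = begin
  (p · q) · (r · s)  ≡⟨ ·-assoc p q (r · s) ⟩
  p · (q · (r · s))  ≡⟨ cong (p ·_) (sym (·-assoc q r s)) ⟩
  p · ((q · r) · s)  ≡⟨ cong (λ t → p · (t · s)) (·-comm q r) ⟩
  p · ((r · q) · s)  ≡⟨ cong (p ·_) (·-assoc r q s) ⟩
  p · (r · (q · s))  ≡⟨ sym (·-assoc p r (q · s)) ⟩
  (p · r) · (q · s)  ∎
  where open ≡-Reasoning

∈-allVecs : (v : Vec Bool n) → v ∈ allVecs n
∈-allVecs []          = here refl
∈-allVecs (false ∷ v) = ∈-++⁺ˡ (∈-map⁺ (false ∷_) (∈-allVecs v))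
∈-allVecs {suc n} (true ∷ v) = ∈-++⁺ʳ (map (false ∷_) (allVecs n)) (∈-map⁺ (true ∷_) (∈-allVecs v))

∈-allG : (g : G) → g ∈ allG
∈-allG = ∈-allVecs

allG-unique : Unique allG
allG-unique = toWitness {a? = unique? allG} tt

all-allG : (p : G → Bool) → T (all p allG) → (g : G) → T (p g)
all-allG p h g = All.lookup (all⁺ p allG h) (∈-allG g)

decide-allG : {P : G → Set} (P? : (g : G) → Dec (P g)) →
              T (all (isYes ∘ P?) allG) → (g : G) → P g
decide-allG P? h g = toWitness (all-allG (isYes ∘ P?) h g)

isAut-id : IsAut id
isAut-id = record { hom = λ _ _ → refl ; σ⁻¹ = id ; left = λ _ → refl ; right = λ _ → refl }

isAut-∘ : {σ τ : G → G} → IsAut σ → IsAut τ → IsAut (σ ∘ τ)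
isAut-∘ {σ} {τ} Aσ Aτ = record
  { hom   = λ a b → trans (cong σ (IsAut.hom Aτ a b)) (IsAut.hom Aσ (τ a) (τ b))
  ; σ⁻¹   = IsAut.σ⁻¹ Aτ ∘ IsAut.σ⁻¹ Aσ
  ; left  = λ x → trans (cong (IsAut.σ⁻¹ Aτ) (IsAut.left Aσ (τ x))) (IsAut.left Aτ x)
  ; right = λ x → trans (cong σ (IsAut.right Aτ (IsAut.σ⁻¹ Aσ x))) (IsAut.right Aσ x)
  }

isAut-σ⁻¹ : {σ : G → G} (Aσ : IsAut σ) → IsAut (IsAut.σ⁻¹ Aσ)
isAut-σ⁻¹ {σ} Aσ = record
  { hom   = λ a b → begin
      σ⁻¹ (a · b)                          ≡⟨ cong σ⁻¹ (sym (cong₂ _·_ (right a) (right b))) ⟩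
      σ⁻¹ (σ (σ⁻¹ a) · σ (σ⁻¹ b))          ≡⟨ cong σ⁻¹ (sym (hom (σ⁻¹ a) (σ⁻¹ b))) ⟩
      σ⁻¹ (σ (σ⁻¹ a · σ⁻¹ b))              ≡⟨ left _ ⟩
      σ⁻¹ a · σ⁻¹ b                        ∎
  ; σ⁻¹   = σ
  ; left  = right
  ; right = left
  }
  where open IsAut Aσ; open ≡-Reasoning

aut-e : {σ : G → G} → IsAut σ → σ e ≡ e
aut-e {σ} Aσ = trans (IsAut.hom Aσ e e) (·-self (σ e))

aut-injective : {σ : G → G} → IsAut σ → {x y : G} → σ x ≡ σ y → x ≡ y
aut-injective Aσ {x} {y} σx≡σy =
  trans (sym (IsAut.left Aσ x)) (trans (cong (IsAut.σ⁻¹ Aσ) σx≡σy) (IsAut.left Aσ y))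

-- Linear maps

E₀ E₁ E₂ E₃ : G
E₀ = true  ∷ false ∷ false ∷ false ∷ []
E₁ = false ∷ true  ∷ false ∷ false ∷ []
E₂ = false ∷ false ∷ true  ∷ false ∷ []
E₃ = false ∷ false ∷ false ∷ true  ∷ []

basis : Vec G 4
basis = E₀ ∷ E₁ ∷ E₂ ∷ E₃ ∷ []

scale : Bool → G → G
scale true  v = v
scale false v = e

linComb : Vec G n → Vec Bool n → G
linComb []       []       = e
linComb (v ∷ vs) (b ∷ bs) = scale b v · linComb vs bs

scale-xor : (a b : Bool) (v : G) → scale (a xor b) v ≡ scale a v · scale b v
scale-xor true  true  v = sym (·-self v)
scale-xor true  false v = sym (·-identityʳ v)
scale-xor false true  v = sym (·-identityˡ v)
scale-xor false false v = refl

linComb-zero : (vs : Vec G n) → linComb vs (replicate n false) ≡ e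
linComb-zero []       = refl
linComb-zero (v ∷ vs) = trans (·-identityˡ _) (linComb-zero vs)

linComb-hom : (vs : Vec G n) (a b : Vec Bool n) →
              linComb vs (zipWith _xor_ a b) ≡ linComb vs a · linComb vs b
linComb-hom []       []       []       = refl
linComb-hom (v ∷ vs) (a ∷ as) (b ∷ bs) = begin
  scale (a xor b) v · linComb vs (zipWith _xor_ as bs)  ≡⟨ cong₂ _·_ (scale-xor a b v) (linComb-hom vs as bs) ⟩
  (scale a v · scale b v) · (linComb vs as · linComb vs bs)  ≡⟨ ·-interchange _ _ _ _ ⟩
  (scale a v · linComb vs as) · (scale b v · linComb vs bs)  ∎
  where open ≡-Reasoning

linComb-scale : (v : Vec G 4) (b : Bool) (w : G) → linComb v (scale b w) ≡ scale b (linComb v w)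
linComb-scale v true  w = refl
linComb-scale v false w = linComb-zero v

linComb-linComb : (v : Vec G 4) (ws : Vec G n) (g : Vec Bool n) →
                  linComb v (linComb ws g) ≡ linComb (Vec.map (linComb v) ws) g
linComb-linComb v []       []       = linComb-zero v
linComb-linComb v (w ∷ ws) (b ∷ bs) = begin
  linComb v (scale b w · linComb ws bs)              ≡⟨ linComb-hom v (scale b w) (linComb ws bs) ⟩
  linComb v (scale b w) · linComb v (linComb ws bs)  ≡⟨ cong₂ _·_ (linComb-scale v b w) (linComb-linComb v ws bs) ⟩
  scale b (linComb v w) · linComb (Vec.map (linComb v) ws) bs  ∎
  where open ≡-Reasoning

linComb-basis : (g : G) → linComb basis g ≡ g
linComb-basis = decide-allG (λ g → linComb basis g ≟G g) tt

_≟V_ : (v w : Vec G 4) → Dec (v ≡ w)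
_≟V_ = ≡-dec _≟G_

IsInverse : Vec G 4 → Vec G 4 → Set
IsInverse v w = Vec.map (linComb v) w ≡ basis × Vec.map (linComb w) v ≡ basis

isInverse? : (v w : Vec G 4) → Dec (IsInverse v w)
isInverse? v w = (Vec.map (linComb v) w ≟V basis) ×-dec (Vec.map (linComb w) v ≟V basis)

linComb-inverse : {v w : Vec G 4} → Vec.map (linComb v) w ≡ basis →
                  (g : G) → linComb v (linComb w g) ≡ g
linComb-inverse {v} {w} vw≡basis g =
  trans (linComb-linComb v w g) (trans (cong (λ u → linComb u g) vw≡basis) (linComb-basis g))

isAut-linComb : {v w : Vec G 4} → IsInverse v w → IsAut (linComb v)
isAut-linComb {v} {w} (vw , wv) = record
  { hom = linComb-hom v ; σ⁻¹ = linComb w ; left = linComb-inverse {w} {v} wv ; right = linComb-inverse {v} {w} vw }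

countᵇ : (A → Bool) → List A → ℕ
countᵇ p xs = length (filterᵇ p xs)

filterᵇ-≐ : {p q : A → Bool} → (T ∘ p) ≐ (T ∘ q) → (xs : List A) → filterᵇ p xs ≡ filterᵇ q xs
filterᵇ-≐ {p = p} {q} = filter-≐ (T? ∘ p) (T? ∘ q)

filterᵇ-cong : {p q : A → Bool} → ((x : A) → p x ≡ q x) → (xs : List A) → filterᵇ p xs ≡ filterᵇ q xs
filterᵇ-cong p≗q = filterᵇ-≐ ((λ {x} → subst T (p≗q x)) , (λ {x} → subst T (sym (p≗q x))))

filterᵇ-filterᵇ : (p q : A → Bool) (xs : List A) →
                  filterᵇ q (filterᵇ p xs) ≡ filterᵇ (λ x → p x ∧ q x) xs
filterᵇ-filterᵇ p q []       = refl
filterᵇ-filterᵇ p q (x ∷ xs) with p x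
... | false = filterᵇ-filterᵇ p q xs
... | true with q x
...   | true  = cong (x ∷_) (filterᵇ-filterᵇ p q xs)
...   | false = filterᵇ-filterᵇ p q xs

filterᵇ-map : (p : B → Bool) (f : A → B) (xs : List A) →
              filterᵇ p (map f xs) ≡ map f (filterᵇ (p ∘ f) xs)
filterᵇ-map p f []       = refl
filterᵇ-map p f (x ∷ xs) with p (f x)
... | true  = cong (f x ∷_) (filterᵇ-map p f xs)
... | false = filterᵇ-map p f xs

countᵇ-split : (p q : A → Bool) (xs : List A) →
               countᵇ p xs ≡ countᵇ (λ x → p x ∧ q x) xs + countᵇ (λ x → p x ∧ not (q x)) xs
countᵇ-split p q []       = refl
countᵇ-split p q (x ∷ xs) with p x
... | false = countᵇ-split p q xs
... | true with q x
...   | true  = cong suc (countᵇ-split p q xs)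
...   | false = trans (cong suc (countᵇ-split p q xs)) (sym (+-suc _ _))

∈⇒1≤length : {xs : List A} {x : A} → x ∈ xs → 1 ≤ length xs
∈⇒1≤length (here _)  = s≤s z≤n
∈⇒1≤length (there _) = s≤s z≤n

∈-length-1 : {xs : List A} {x y : A} → length xs ≡ 1 → x ∈ xs → y ∈ xs → x ≡ y
∈-length-1 {xs = _ ∷ []} _ (here refl) (here refl) = refl

map-allG-↭ : {σ : G → G} → IsAut σ → map σ allG ↭ allG
map-allG-↭ {σ} Aσ = ∼bag⇒↭ (unique∧set⇒bag
  (Unique.map⁺ (aut-injective Aσ) allG-unique) allG-unique
  λ {x} → mk⇔ (λ _ → ∈-allG x)
               (λ _ → subst (_∈ map σ allG) (IsAut.right Aσ x) (∈-map⁺ σ (∈-allG (IsAut.σ⁻¹ Aσ x)))))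

countᵇ-reindex : {σ : G → G} → IsAut σ → (p : G → Bool) → countᵇ (p ∘ σ) allG ≡ countᵇ p allG
countᵇ-reindex {σ} Aσ p = begin
  length (filterᵇ (p ∘ σ) allG)          ≡⟨ sym (length-map σ (filterᵇ (p ∘ σ) allG)) ⟩
  length (map σ (filterᵇ (p ∘ σ) allG))  ≡⟨ cong length (sym (filterᵇ-map p σ allG)) ⟩
  length (filterᵇ p (map σ allG))        ≡⟨ ↭-length (filter-↭ (T? ∘ p) (map-allG-↭ Aσ)) ⟩
  length (filterᵇ p allG)                ∎
  where open ≡-Reasoning

-- Partitions of G given by a labelling

classOf : (G → ℕ) → G → G → Bool
classOf lab x g = lab g ≡ᵇ lab x

classOf-⇔ : (lab : G → ℕ) {x g : G} → T (classOf lab x g) ⇔ (lab g ≡ lab x)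
classOf-⇔ lab {x} {g} = mk⇔ (≡ᵇ⇒≡ (lab g) (lab x)) (≡⇒≡ᵇ (lab g) (lab x))

classSize : (G → ℕ) → G → ℕ
classSize lab x = countᵇ (classOf lab x) allG

intersectionNumber : (G → ℕ) → G → G → G → ℕ
intersectionNumber lab x y z = countᵇ (λ a → classOf lab x a ∧ classOf lab y (a · z)) allG

record IsRegular2Partition (lab : G → ℕ) : Set where
  field
    singleton-e        : (g : G) → lab g ≡ lab e → g ≡ e
    classSize-pow2     : (x : G) → ∃[ k ] classSize lab x ≡ 2 ^ k
    intersection-const : (x y : G) {z z′ : G} → lab z ≡ lab z′ →
                         intersectionNumber lab x y z ≡ intersectionNumber lab x y z′

indicator : Bool → ℤ
indicator b = if b then ℤ.+ 1 else ℤ.+ 0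

sum-indicator-product : (p q : A → Bool) (xs : List A) →
  foldr ℤ._+_ (ℤ.+ 0) (map (λ a → indicator (p a) ℤ.* indicator (q a)) xs)
    ≡ ℤ.+ countᵇ (λ a → p a ∧ q a) xs
sum-indicator-product p q []       = refl
sum-indicator-product p q (a ∷ xs) with p a | q a
... | true  | true  = cong (ℤ._+_ (ℤ.+ 1)) (sum-indicator-product p q xs)
... | true  | false = trans (ℤ.+-identityˡ _) (sum-indicator-product p q xs)
... | false | true  = trans (ℤ.+-identityˡ _) (sum-indicator-product p q xs)
... | false | false = trans (ℤ.+-identityˡ _) (sum-indicator-product p q xs)

classIndicator : (G → ℕ) → G → ℤG
classIndicator lab x = indicator ∘ classOf lab x

classIndicator-⋆ : (lab : G → ℕ) (x y z : G) →
  (classIndicator lab x ⋆ classIndicator lab y) z ≡ ℤ.+ intersectionNumber lab x y z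
classIndicator-⋆ lab x y z =
  sum-indicator-product (classOf lab x) (λ a → classOf lab y (a · z)) allG

blockSize≡classSize : (lab : G → ℕ) (x : G) → blockSize lab x ≡ classSize lab x
blockSize≡classSize lab x = cong length
  (filter-≐ (λ y → lab y ≟ lab x) (T? ∘ classOf lab x)
            (from (classOf-⇔ lab) , to (classOf-⇔ lab)) allG)

Is2SRing⇒IsRegular2Partition : (lab : G → ℕ) → Is2SRing lab → IsRegular2Partition lab
Is2SRing⇒IsRegular2Partition lab S = record
  { singleton-e        = IsSRing.singleton-e R
  ; classSize-pow2     = λ x → let k , size≡ = Is2SRing.two-pow S x
                               in k , trans (sym (blockSize≡classSize lab x)) size≡
  ; intersection-const = λ x y {z} {z′} z∼z′ → ℤ.+-injective (begin
      ℤ.+ intersectionNumber lab x y z   ≡⟨ sym (classIndicator-⋆ lab x y z) ⟩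
      (classIndicator lab x ⋆ classIndicator lab y) z   ≡⟨ product-in-span x y z z′ z∼z′ ⟩
      (classIndicator lab x ⋆ classIndicator lab y) z′  ≡⟨ classIndicator-⋆ lab x y z′ ⟩
      ℤ.+ intersectionNumber lab x y z′  ∎)
  }
  where
  open ≡-Reasoning
  R = Is2SRing.isSRing S
  indicator-span : (x : G) → InSpan lab (classIndicator lab x)
  indicator-span x = (λ k → indicator (k ≡ᵇ lab x)) , λ _ → refl
  product-in-span : (x y z z′ : G) → lab z ≡ lab z′ →
    (classIndicator lab x ⋆ classIndicator lab y) z ≡ (classIndicator lab x ⋆ classIndicator lab y) z′
  product-in-span x y z z′ z∼z′ =
    let c , in-span = IsSRing.mul-closed R _ _ (indicator-span x) (indicator-span y)
    in trans (in-span z) (trans (cong c z∼z′) (sym (in-span z′)))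

IsRegular2Partition-∘ : {lab : G → ℕ} {φ : G → G} → IsAut φ →
                      IsRegular2Partition lab → IsRegular2Partition (lab ∘ φ)
IsRegular2Partition-∘ {lab} {φ} Aφ S = record
  { singleton-e        = λ g φg∼e →
      aut-injective Aφ (trans (singleton-e (φ g) (trans φg∼e (cong lab φe))) (sym φe))
  ; classSize-pow2     = λ x → let k , size≡ = classSize-pow2 (φ x)
                               in k , trans (countᵇ-reindex Aφ (classOf lab (φ x))) size≡
  ; intersection-const = λ x y {z} {z′} z∼z′ →
      trans (reindex x y z) (trans (intersection-const (φ x) (φ y) z∼z′) (sym (reindex x y z′)))
  }
  where
  open IsRegular2Partition S
  φe : φ e ≡ e
  φe = aut-e Aφ
  reindex : (x y z : G) → intersectionNumber (lab ∘ φ) x y z ≡ intersectionNumber lab (φ x) (φ y) (φ z)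
  reindex x y z = trans
    (cong length (filterᵇ-cong (λ a → cong (λ t → classOf lab (φ x) (φ a) ∧ classOf lab (φ y) t)
                                           (IsAut.hom Aφ a z)) allG))
    (countᵇ-reindex Aφ (λ b → classOf lab (φ x) b ∧ classOf lab (φ y) (b · φ z)))

Preserves : (G → ℕ) → (G → G) → Set
Preserves lab σ = (z : G) → lab (σ z) ≡ lab z

Stabilizer : (G → ℕ) → (G → G) → Set
Stabilizer lab σ = IsAut σ × Preserves lab σ

stabilizer-isAutSubgroup : (lab : G → ℕ) → IsAutSubgroup (Stabilizer lab)
stabilizer-isAutSubgroup lab = record
  { auts    = λ _ → proj₁
  ; has-id  = isAut-id , λ _ → refl
  ; comp    = λ σ τ (Aσ , pσ) (Aτ , pτ) → isAut-∘ Aσ Aτ , λ z → trans (pσ (τ z)) (pτ z)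
  ; inverse = λ σ (Aσ , pσ) →
      IsAut.σ⁻¹ Aσ , (isAut-σ⁻¹ Aσ , λ z → trans (sym (pσ _)) (cong lab (IsAut.right Aσ z))) , IsAut.left Aσ
  }

ClassesAreOrbits : (G → ℕ) → Set
ClassesAreOrbits lab = (x y : G) → lab x ≡ lab y → ∃[ σ ] Stabilizer lab σ × σ x ≡ y

ClassesAreOrbits⇒Cyclotomic : (lab : G → ℕ) → ClassesAreOrbits lab → Cyclotomic lab
ClassesAreOrbits⇒Cyclotomic lab orbits =
  Stabilizer lab , stabilizer-isAutSubgroup lab ,
  λ x y → orbits x y , λ (σ , (_ , pσ) , σx≡y) → trans (sym (pσ x)) (cong lab σx≡y)

ClassesAreOrbits-∘ : {lab : G → ℕ} {φ : G → G} → IsAut φ →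
                     ClassesAreOrbits (lab ∘ φ) → ClassesAreOrbits lab
ClassesAreOrbits-∘ {lab} {φ} Aφ orbits x y x∼y =
  let σ , (Aσ , pσ) , σψx≡ψy = orbits (ψ x) (ψ y) (trans (cong lab (φψ x)) (trans x∼y (cong lab (sym (φψ y)))))
  in φ ∘ σ ∘ ψ ,
     (isAut-∘ Aφ (isAut-∘ Aσ (isAut-σ⁻¹ Aφ)) , λ z → trans (pσ (ψ z)) (cong lab (φψ z))) ,
     trans (cong φ σψx≡ψy) (φψ y)
  where
  ψ = IsAut.σ⁻¹ Aφ
  φψ = IsAut.right Aφ

orbit-through : {lab : G → ℕ} {σ τ : G → G} {r x y : G} →
                Stabilizer lab σ → Stabilizer lab τ → σ r ≡ x → τ r ≡ y →
                ∃[ ρ ] Stabilizer lab ρ × ρ x ≡ y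
orbit-through {lab} {σ} {τ} Sσ Sτ σr≡x τr≡y =
  let σ⁻¹ , Sσ⁻¹ , σ⁻¹σ = inverse σ Sσ
  in τ ∘ σ⁻¹ , comp τ σ⁻¹ Sτ Sσ⁻¹ ,
     trans (cong (τ ∘ σ⁻¹) (sym σr≡x)) (trans (cong τ (σ⁻¹σ _)) τr≡y)
  where open IsAutSubgroup (stabilizer-isAutSubgroup lab)

-- A singleton basic set other than {e}

UnionOfClasses : (G → ℕ) → (G → Bool) → Set
UnionOfClasses lab Q = (g h : G) → T (Q g) → lab h ≡ lab g → T (Q h)

unionOfEvenClasses-even : (lab : G → ℕ) (Q : G → Bool) → UnionOfClasses lab Q →
                          ((g : G) → T (Q g) → 2 ∣ classSize lab g) → 2 ∣ countᵇ Q allG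
unionOfEvenClasses-even lab Q = go (suc (countᵇ Q allG)) Q (n<1+n _)
  where
  go : (fuel : ℕ) (Q : G → Bool) → countᵇ Q allG < fuel → UnionOfClasses lab Q →
       ((g : G) → T (Q g) → 2 ∣ classSize lab g) → 2 ∣ countᵇ Q allG
  go zero Q () closed even
  go (suc fuel) Q bound closed even with any? (T? ∘ Q) allG
  ... | no none = subst (2 ∣_) (sym (cong length (filter-none (T? ∘ Q) (All.tabulate λ x∈ Qx → none (lose x∈ Qx)))))
                  (divides 0 refl)
  ... | yes some = subst (2 ∣_) (sym split) (∣m∣n⇒∣m+n (subst (2 ∣_) class≡ (even g Qg)) rest-even)
    where
    g = proj₁ (find some)
    Qg = proj₂ (proj₂ (find some))
    C = classOf lab g
    Q′ : G → Bool
    Q′ h = Q h ∧ not (C h)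
    split : countᵇ Q allG ≡ countᵇ (λ h → Q h ∧ C h) allG + countᵇ Q′ allG
    split = countᵇ-split Q C allG
    class≡ : classSize lab g ≡ countᵇ (λ h → Q h ∧ C h) allG
    class≡ = cong length (filterᵇ-≐ ((λ {h} Ch → from T-∧ (closed g h Qg (to (classOf-⇔ lab) Ch) , Ch)) ,
                                     proj₂ ∘ to T-∧) allG)
    closed′ : UnionOfClasses lab Q′
    closed′ h h′ Q′h h′∼h = let Qh , ¬Ch = to T-∧ Q′h in
      from T-∧ (closed h h′ Qh h′∼h ,
                from T-not λ Ch′ →
                  to T-not ¬Ch (from (classOf-⇔ lab) (trans (sym h′∼h) (to (classOf-⇔ lab) Ch′))))
    class≥1 : 1 ≤ countᵇ (λ h → Q h ∧ C h) allG
    class≥1 = subst (1 ≤_) class≡ (∈⇒1≤length (∈-filter⁺ (T? ∘ C) (∈-allG g) (from (classOf-⇔ lab) refl)))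
    rest-even : 2 ∣ countᵇ Q′ allG
    rest-even = go fuel Q′
      (≤-trans (+-monoˡ-≤ _ class≥1) (subst (_≤ fuel) split (≤-pred bound)))
      closed′ (λ h Q′h → even h (proj₁ (to T-∧ Q′h)))

nonIdentity : G → Bool
nonIdentity g = not (isYes (g ≟G e))

nontrivial-singleton : (lab : G → ℕ) → IsRegular2Partition lab →
                       ∃[ a ] a ≢ e × ((g : G) → lab g ≡ lab a → g ≡ a)
nontrivial-singleton lab S with any? (λ g → ¬? (g ≟G e) ×-dec (classSize lab g ≟ 1)) allG
... | yes found =
  let a , _ , a≢e , size≡1 = find found
      ∈-class : (g : G) → lab g ≡ lab a → g ∈ filterᵇ (classOf lab a) allG
      ∈-class g g∼a = ∈-filter⁺ (T? ∘ classOf lab a) (∈-allG g) (from (classOf-⇔ lab) g∼a)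
  in a , a≢e , λ g g∼a → ∈-length-1 size≡1 (∈-class g g∼a) (∈-class a refl)
  where open IsRegular2Partition S
-- countᵇ nonIdentity allG computes to 15.
... | no none = ⊥-elim (toWitnessFalse {a? = 2 ∣? 15} tt (unionOfEvenClasses-even lab nonIdentity closed even))
  where
  open IsRegular2Partition S
  closed : UnionOfClasses lab nonIdentity
  closed g h g≢e h∼g = from T-not λ h≡e →
    to T-not g≢e (fromWitness (singleton-e g (trans (sym h∼g) (cong lab (toWitness h≡e)))))
  even : (g : G) → T (nonIdentity g) → 2 ∣ classSize lab g
  even g g≢e with classSize-pow2 g
  ... | zero  , size≡1 = ⊥-elim (none (lose (∈-allG g) ((λ g≡e → to T-not g≢e (fromWitness g≡e)) , size≡1)))
  ... | suc k , size≡  = divides (2 ^ k) (trans size≡ (*-comm 2 (2 ^ k)))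

-- E₃ is sent to a, and E₃ takes the place of a standard basis vector on which a is nonzero.
transporter : G → Vec G 4
transporter a@(true ∷ _)                = E₃ ∷ E₁ ∷ E₂ ∷ a ∷ []
transporter a@(false ∷ true ∷ _)        = E₀ ∷ E₃ ∷ E₂ ∷ a ∷ []
transporter a@(false ∷ false ∷ true ∷ _) = E₀ ∷ E₁ ∷ E₃ ∷ a ∷ []
transporter a                           = E₀ ∷ E₁ ∷ E₂ ∷ a ∷ []

-- Junk value e when t has no preimage; isInverse? checks the result afterwards.
preimage : Vec G 4 → G → G
preimage v t = scan allG
  where
  scan : List G → G
  scan []       = e
  scan (h ∷ hs) = if does (linComb v h ≟G t) then h else scan hs

inverseMatrix : Vec G 4 → Vec G 4
inverseMatrix v = Vec.map (preimage v) basis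

transporter-E₃ : (a : G) → linComb (transporter a) E₃ ≡ a
transporter-E₃ = decide-allG (λ a → linComb (transporter a) E₃ ≟G a) tt

transporter-isAut : {a : G} → a ≢ e → IsAut (linComb (transporter a))
transporter-isAut {a} a≢e
  with decide-allG (λ a → a ≟G e ⊎-dec isInverse? (transporter a) (inverseMatrix (transporter a))) tt a
... | inj₁ a≡e = ⊥-elim (a≢e a≡e)
... | inj₂ inv = isAut-linComb inv

data Trie (A : Set) : ℕ → Set where
  leaf : A → Trie A zero
  node : Trie A n → Trie A n → Trie A (suc n)

lookupᵗ : Trie A n → Vec Bool n → A
lookupᵗ (leaf a)   []          = a
lookupᵗ (node l r) (false ∷ v) = lookupᵗ l v
lookupᵗ (node l r) (true ∷ v)  = lookupᵗ r v

tabulateᵗ : (n : ℕ) → (Vec Bool n → A) → Trie A n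
tabulateᵗ zero    f = leaf (f [])
tabulateᵗ (suc n) f = node (tabulateᵗ n (f ∘ (false ∷_))) (tabulateᵗ n (f ∘ (true ∷_)))

∅ᵗ : (n : ℕ) → Trie Bool n
∅ᵗ zero    = leaf false
∅ᵗ (suc n) = node (∅ᵗ n) (∅ᵗ n)

insertᵗ : Vec Bool n → Trie Bool n → Trie Bool n
insertᵗ []          (leaf _)   = leaf true
insertᵗ (false ∷ v) (node l r) = node (insertᵗ v l) r
insertᵗ (true ∷ v)  (node l r) = node l (insertᵗ v r)

lookup-∅ᵗ : (g : Vec Bool n) → lookupᵗ (∅ᵗ n) g ≡ false
lookup-∅ᵗ []          = refl
lookup-∅ᵗ (false ∷ g) = lookup-∅ᵗ g
lookup-∅ᵗ (true ∷ g)  = lookup-∅ᵗ g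

lookup-insertᵗ-≡ : (v : Vec Bool n) (t : Trie Bool n) → lookupᵗ (insertᵗ v t) v ≡ true
lookup-insertᵗ-≡ []          (leaf _)   = refl
lookup-insertᵗ-≡ (false ∷ v) (node l r) = lookup-insertᵗ-≡ v l
lookup-insertᵗ-≡ (true ∷ v)  (node l r) = lookup-insertᵗ-≡ v r

lookup-insertᵗ-≢ : {v g : Vec Bool n} (t : Trie Bool n) → g ≢ v → lookupᵗ (insertᵗ v t) g ≡ lookupᵗ t g
lookup-insertᵗ-≢ {v = []}      {[]}      (leaf _)   g≢v = ⊥-elim (g≢v refl)
lookup-insertᵗ-≢ {v = false ∷ v} {false ∷ g} (node l r) g≢v = lookup-insertᵗ-≢ l (g≢v ∘ cong (false ∷_))
lookup-insertᵗ-≢ {v = false ∷ v} {true ∷ g}  (node l r) g≢v = refl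
lookup-insertᵗ-≢ {v = true ∷ v}  {false ∷ g} (node l r) g≢v = refl
lookup-insertᵗ-≢ {v = true ∷ v}  {true ∷ g}  (node l r) g≢v = lookup-insertᵗ-≢ r (g≢v ∘ cong (true ∷_))

Mask : Set
Mask = Trie Bool 4

maskOf : List G → Mask
maskOf = foldr insertᵗ (∅ᵗ 4)

lookup-maskOf : (xs : List G) {g : G} → T (lookupᵗ (maskOf xs) g) ⇔ g ∈ xs
lookup-maskOf []       {g} = mk⇔ (λ t → ⊥-elim (subst T (lookup-∅ᵗ g) t)) λ ()
lookup-maskOf (x ∷ xs) {g} with g ≟G x
... | yes refl = mk⇔ (λ _ → here refl) (λ _ → subst T (sym (lookup-insertᵗ-≡ g (maskOf xs))) tt)
... | no g≢x   = mk⇔ (λ t → there (to (lookup-maskOf xs) (subst T (lookup-insertᵗ-≢ (maskOf xs) g≢x) t)))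
                     λ { (here g≡x) → ⊥-elim (g≢x g≡x)
                       ; (there g∈) → subst T (sym (lookup-insertᵗ-≢ (maskOf xs) g≢x)) (from (lookup-maskOf xs) g∈) }

combinations : ℕ → List A → List (List A)
combinations zero    xs       = [] ∷ []
combinations (suc k) []       = []
combinations (suc k) (x ∷ xs) = map (x ∷_) (combinations k xs) ++ combinations (suc k) xs

⊆⇒∈-combinations : {xs ys : List A} → ys ⊆ xs → ys ∈ combinations (length ys) xs
⊆⇒∈-combinations []               = here refl
⊆⇒∈-combinations {ys = []}     (x ∷ʳ _) = here refl
⊆⇒∈-combinations {ys = _ ∷ _} (x ∷ʳ ys⊆xs) = ∈-++⁺ʳ _ (⊆⇒∈-combinations ys⊆xs)
⊆⇒∈-combinations (refl ∷ ys⊆xs) = ∈-++⁺ˡ (∈-map⁺ _ (⊆⇒∈-combinations ys⊆xs))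

sizes∸1 : List ℕ
sizes∸1 = 0 ∷ 1 ∷ 3 ∷ 7 ∷ []

pow2≤15⇒∈sizes∸1 : {c k : ℕ} → suc c ≡ 2 ^ k → 2 ^ k ≤ 15 → c ∈ sizes∸1
pow2≤15⇒∈sizes∸1 {k = 0} eq _ = here (suc-injective eq)
pow2≤15⇒∈sizes∸1 {k = 1} eq _ = there (here (suc-injective eq))
pow2≤15⇒∈sizes∸1 {k = 2} eq _ = there (there (here (suc-injective eq)))
pow2≤15⇒∈sizes∸1 {k = 3} eq _ = there (there (there (here (suc-injective eq))))
pow2≤15⇒∈sizes∸1 {k = suc (suc (suc (suc k)))} _ bound =
  ⊥-elim (<-irrefl refl (≤-trans (^-monoʳ-≤ 2 {4} {suc (suc (suc (suc k)))} (s≤s (s≤s (s≤s (s≤s z≤n))))) bound))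

-- The search

record Block : Set where
  constructor block
  field
    mask    : Mask
    members : List G
open Block

-- A record expression here instead of the constructor makes the search several times slower.
toBlock : Mask → Block
toBlock m = block m (filterᵇ (lookupᵗ m) allG)

hits : Block → Block → G → ℕ
hits X Y z = countᵇ (λ x → lookupᵗ (mask Y) (x · z)) (members X)

takesValue : (G → ℕ) → ℕ → List G → Bool
takesValue C c = all (λ w → c ≡ᵇ C w)

constantOn : (G → ℕ) → List G → Bool
constantOn C []       = true
constantOn C (z ∷ zs) = takesValue C (C z) zs

regular : Block → Block → Block → Bool
regular X Y Z = constantOn (hits X Y) (members Z)

compatible : List Block → Block → Bool
compatible done B = all (λ X → all (regular X B) (B ∷ done)) (B ∷ done)
                  ∧ all (λ X → all (λ Y → regular X Y B) done) done

blockIndex : List Block → G → ℕ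
blockIndex []       g = 0
blockIndex (B ∷ Bs) g = if lookupᵗ (mask B) g then 0 else suc (blockIndex Bs g)

-- Pairs (g, φ g) for g in the span of the basis vectors treated so far.
Graph : Set
Graph = List (G × G)

extensions : Trie ℕ 4 → G → Graph → List (G × Graph)
extensions L E gr = concatMap step allG
  where
  step : G → List (G × Graph)
  step v = let new = map (λ pq → proj₁ pq · E , proj₂ pq · v) gr in
    if all (λ pq → lookupᵗ L (proj₁ pq) ≡ᵇ lookupᵗ L (proj₂ pq)) new then (v , gr ++ new) ∷ [] else []

labelPreservingImages : Trie ℕ 4 → Vec G n → Graph → List (Vec G n)
labelPreservingImages L []       gr = [] ∷ []
labelPreservingImages L (E ∷ Es) gr =
  concatMap (λ vg → map (proj₁ vg ∷_) (labelPreservingImages L Es (proj₂ vg))) (extensions L E gr)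

preservesBlocks : List Block → (G → G) → Bool
preservesBlocks done σ = all (λ B → all (λ g → not (lookupᵗ (mask B) g) ∨ lookupᵗ (mask B) (σ g)) allG) done

candidateMatrices : List Block → List (Vec G 4 × Vec G 4)
candidateMatrices done =
  map (λ v → v , inverseMatrix v) (labelPreservingImages (tabulateᵗ 4 (blockIndex done)) basis ((e , e) ∷ []))

isStabilizerMatrix : List Block → Vec G 4 × Vec G 4 → Bool
isStabilizerMatrix done (v , w) = isYes (isInverse? v w) ∧ preservesBlocks done (linComb v)

stabilizerMatrices : List Block → List (Vec G 4 × Vec G 4)
stabilizerMatrices done = filterᵇ (isStabilizerMatrix done) (candidateMatrices done)

withinOrbit : List (Vec G 4 × Vec G 4) → List G → Bool
withinOrbit Ms []       = true
withinOrbit Ms (r ∷ rs) = all (λ y → any (λ vw → isYes (linComb (proj₁ vw) r ≟G y)) Ms) (r ∷ rs)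

-- Taking Ms as an argument shares one computation of the stabiliser among all blocks.
blocksWithinOrbits : List (Vec G 4 × Vec G 4) → List Block → Bool
blocksWithinOrbits Ms = all (withinOrbit Ms ∘ members)

orbitsOK : List Block → Bool
orbitsOK done = blocksWithinOrbits (stabilizerMatrices done) done

candidates : G → List G → List Mask
candidates f rest = concatMap (λ c → map (maskOf ∘ (f ∷_)) (combinations c rest)) sizes∸1

search : ℕ → List Block → List G → Bool
search zero    done rem        = false
search (suc n) done []         = orbitsOK done
search (suc n) done (f ∷ rest) = all (λ m → not (compatible done (toBlock m))
  ∨ search n (toBlock m ∷ done) (filterᵇ (not ∘ lookupᵗ m) (f ∷ rest))) (candidates f rest)

covered : List Block → G → Bool
covered done g = any (λ B → lookupᵗ (mask B) g) done

uncovered : List Block → List G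
uncovered done = filterᵇ (not ∘ covered done) allG

initialBlocks : List Block
initialBlocks = toBlock (maskOf (E₃ ∷ [])) ∷ toBlock (maskOf (e ∷ [])) ∷ []

-- Any fuel exceeding the number of classes would do.
searchOK : search 20 initialBlocks (uncovered initialBlocks) ≡ true
searchOK = refl

-- Soundness of the search

constantOn-complete : (C : G → ℕ) (zs : List G) → ({w w′ : G} → w ∈ zs → w′ ∈ zs → C w ≡ C w′) →
                      T (constantOn C zs)
constantOn-complete C []       _     = tt
constantOn-complete C (z ∷ zs) const = all⁻ _ (All.tabulate λ w∈ → ≡⇒≡ᵇ _ _ (const (here refl) (there w∈)))

module SearchSoundness (lab : G → ℕ) (S : IsRegular2Partition lab) where
  open IsRegular2Partition S

  record IsClassBlock (B : Block) : Set where
    field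
      rep        : G
      mask-class : (g : G) → lookupᵗ (mask B) g ≡ classOf lab rep g
      members≡   : members B ≡ filterᵇ (lookupᵗ (mask B)) allG
  open IsClassBlock

  mask⇔class : {B : Block} (cB : IsClassBlock B) {g : G} → T (lookupᵗ (mask B) g) ⇔ (lab g ≡ lab (rep cB))
  mask⇔class cB {g} = mk⇔ (to (classOf-⇔ lab) ∘ subst T (mask-class cB g))
                          (subst T (sym (mask-class cB g)) ∘ from (classOf-⇔ lab))

  members⇔class : {B : Block} (cB : IsClassBlock B) {g : G} → g ∈ members B ⇔ (lab g ≡ lab (rep cB))
  members⇔class {B} cB {g} = mk⇔
    (λ g∈ → to (mask⇔class cB)
               (proj₂ (∈-filter⁻ (T? ∘ lookupᵗ (mask B)) (subst (g ∈_) (members≡ cB) g∈))))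
    (λ g∼ → subst (g ∈_) (sym (members≡ cB))
               (∈-filter⁺ (T? ∘ lookupᵗ (mask B)) (∈-allG g) (from (mask⇔class cB) g∼)))

  hits≡intersectionNumber : {X Y : Block} (cX : IsClassBlock X) (cY : IsClassBlock Y) (w : G) →
                            hits X Y w ≡ intersectionNumber lab (rep cX) (rep cY) w
  hits≡intersectionNumber {X} {Y} cX cY w = begin
    countᵇ (λ x → lookupᵗ (mask Y) (x · w)) (members X)
      ≡⟨ cong (countᵇ _) (members≡ cX) ⟩
    countᵇ (λ x → lookupᵗ (mask Y) (x · w)) (filterᵇ (lookupᵗ (mask X)) allG)
      ≡⟨ cong length (filterᵇ-filterᵇ (lookupᵗ (mask X)) (λ x → lookupᵗ (mask Y) (x · w)) allG) ⟩
    countᵇ (λ x → lookupᵗ (mask X) x ∧ lookupᵗ (mask Y) (x · w)) allG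
      ≡⟨ cong length (filterᵇ-cong (λ x → cong₂ _∧_ (mask-class cX x) (mask-class cY (x · w))) allG) ⟩
    intersectionNumber lab (rep cX) (rep cY) w  ∎
    where open ≡-Reasoning

  regular-sound : {X Y Z : Block} → IsClassBlock X → IsClassBlock Y → IsClassBlock Z → T (regular X Y Z)
  regular-sound {X} {Y} {Z} cX cY cZ = constantOn-complete (hits X Y) (members Z) λ w∈ w′∈ →
    trans (hits≡intersectionNumber cX cY _)
   (trans (intersection-const (rep cX) (rep cY) (trans (to (members⇔class cZ) w∈) (sym (to (members⇔class cZ) w′∈))))
          (sym (hits≡intersectionNumber cX cY _)))

  compatible-sound : {B : Block} {done : List Block} → All IsClassBlock (B ∷ done) → T (compatible done B)
  compatible-sound all-class@(cB ∷ cdone) = from T-∧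
    ( all⁻ _ (All.tabulate λ X∈ → all⁻ _ (All.tabulate λ Z∈ →
        regular-sound (All.lookup all-class X∈) cB (All.lookup all-class Z∈)))
    , all⁻ _ (All.tabulate λ X∈ → all⁻ _ (All.tabulate λ Y∈ →
        regular-sound (All.lookup cdone X∈) (All.lookup cdone Y∈) cB)))

  record Invariant (done : List Block) (rem : List G) : Set where
    field
      class-blocks  : All IsClassBlock done
      rem≡uncovered : rem ≡ uncovered done
      e-covered     : T (covered done e)

  ∈-uncovered⇔ : {done : List Block} {g : G} → g ∈ uncovered done ⇔ (¬ T (covered done g))
  ∈-uncovered⇔ {done} {g} = mk⇔
    (to T-not ∘ proj₂ ∘ ∈-filter⁻ (T? ∘ not ∘ covered done))
    (∈-filter⁺ (T? ∘ not ∘ covered done) (∈-allG g) ∘ from T-not)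

  uncovered-closed : {done : List Block} → All IsClassBlock done → {g h : G} →
                     g ∈ uncovered done → lab h ≡ lab g → h ∈ uncovered done
  uncovered-closed {done} classes g∈ h∼g = from (∈-uncovered⇔ {done}) λ h-covered →
    let B , B∈ , Bh = find (any⁻ _ done h-covered)
        cB = All.lookup classes B∈
    in to (∈-uncovered⇔ {done}) g∈
         (any⁺ _ (lose B∈ (from (mask⇔class cB) (trans (sym h∼g) (to (mask⇔class cB) Bh)))))

  module Step {done : List Block} {f : G} {rest : List G} (inv : Invariant done (f ∷ rest)) where
    open Invariant inv

    C : G → Bool
    C = classOf lab f

    m : Mask
    m = maskOf (f ∷ filterᵇ C rest)

    f-uncovered : f ∈ uncovered done
    f-uncovered = subst (f ∈_) rem≡uncovered (here refl)

    class⊆rem : {g : G} → lab g ≡ lab f → g ∈ f ∷ rest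
    class⊆rem g∼f = subst (_ ∈_) (sym rem≡uncovered) (uncovered-closed class-blocks f-uncovered g∼f)

    m-class : (g : G) → lookupᵗ m g ≡ C g
    m-class g = T-injective (mk⇔
      (member⇒class ∘ to (lookup-maskOf (f ∷ filterᵇ C rest)))
      (λ Cg → from (lookup-maskOf (f ∷ filterᵇ C rest)) (class⇒member Cg (class⊆rem (to (classOf-⇔ lab) Cg)))))
      where
      member⇒class : g ∈ f ∷ filterᵇ C rest → T (C g)
      member⇒class (here refl) = from (classOf-⇔ lab) refl
      member⇒class (there g∈)  = proj₂ (∈-filter⁻ (T? ∘ C) {xs = rest} g∈)
      class⇒member : T (C g) → g ∈ f ∷ rest → g ∈ f ∷ filterᵇ C rest
      class⇒member Cg (here g≡f) = here g≡f
      class⇒member Cg (there g∈) = there (∈-filter⁺ (T? ∘ C) g∈ Cg)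

    m-block : IsClassBlock (toBlock m)
    m-block = record { rep = f ; mask-class = m-class ; members≡ = refl }

    size : suc (countᵇ C rest) ≡ classSize lab f
    size = begin
      suc (countᵇ C rest)
        ≡⟨ cong length (sym (filter-accept (T? ∘ C) (from (classOf-⇔ lab) refl))) ⟩
      countᵇ C (f ∷ rest)
        ≡⟨ cong (countᵇ C) rem≡uncovered ⟩
      countᵇ C (filterᵇ (not ∘ covered done) allG)
        ≡⟨ cong length (filterᵇ-filterᵇ (not ∘ covered done) C allG) ⟩
      countᵇ (λ g → not (covered done g) ∧ C g) allG
        ≡⟨ cong length (filterᵇ-≐ {p = λ g → not (covered done g) ∧ C g} {q = C}
                                  (proj₂ ∘ to T-∧ , λ Cg → from T-∧ (uncovered-of Cg , Cg)) allG) ⟩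
      countᵇ C allG  ∎
      where
      open ≡-Reasoning
      uncovered-of : {g : G} → T (C g) → T (not (covered done g))
      uncovered-of Cg = from T-not (to (∈-uncovered⇔ {done})
        (uncovered-closed class-blocks f-uncovered (to (classOf-⇔ lab) Cg)))

    e∉class : ¬ T (C e)
    e∉class Ce = to (∈-uncovered⇔ {done}) f-uncovered
      (subst (T ∘ covered done) (sym (singleton-e f (sym (to (classOf-⇔ lab) Ce)))) e-covered)

    classSize≤15 : classSize lab f ≤ 15
    classSize≤15 = subst (_≤ 15) (cong length (sym (filter-reject (T? ∘ C) e∉class)))
                         (length-filter (T? ∘ C) (drop 1 allG))

    m∈candidates : m ∈ candidates f rest
    m∈candidates =
      let k , size≡ = classSize-pow2 f
      in ∈-concat⁺′
           (∈-map⁺ (maskOf ∘ (f ∷_)) (⊆⇒∈-combinations {xs = rest} (filter-⊆ (T? ∘ C) rest)))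
           (∈-map⁺ (λ c → map (maskOf ∘ (f ∷_)) (combinations c rest))
                   (pow2≤15⇒∈sizes∸1 {k = k} (trans size size≡) (subst (_≤ 15) size≡ classSize≤15)))

    next : Invariant (toBlock m ∷ done) (filterᵇ (not ∘ lookupᵗ m) (f ∷ rest))
    next = record
      { class-blocks  = m-block ∷ class-blocks
      ; rem≡uncovered = begin
          filterᵇ (not ∘ lookupᵗ m) (f ∷ rest)
            ≡⟨ cong (filterᵇ (not ∘ lookupᵗ m)) rem≡uncovered ⟩
          filterᵇ (not ∘ lookupᵗ m) (filterᵇ (not ∘ covered done) allG)
            ≡⟨ filterᵇ-filterᵇ (not ∘ covered done) (not ∘ lookupᵗ m) allG ⟩
          filterᵇ (λ g → not (covered done g) ∧ not (lookupᵗ m g)) allG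
            ≡⟨ filterᵇ-cong {q = not ∘ covered (toBlock m ∷ done)} (λ g →
                 trans (∧-comm (not (covered done g)) _) (sym (not-∨ (lookupᵗ m g) (covered done g)))) allG ⟩
          uncovered (toBlock m ∷ done)  ∎
      ; e-covered     = from T-∨ (inj₂ e-covered)
      }
      where open ≡-Reasoning

  leaf-sound : {done : List Block} → All IsClassBlock done → ((g : G) → T (covered done g)) →
               T (orbitsOK done) → ClassesAreOrbits lab
  leaf-sound {done} classes cov ok x y x∼y =
    let B , B∈ , Bx = find (any⁻ _ done (cov x))
        cB = All.lookup classes B∈
        x∼rep = to (mask⇔class cB) Bx
    in withinOrbit-sound (All.lookup (all⁺ _ done ok) B∈)
         (from (members⇔class cB) x∼rep) (from (members⇔class cB) (trans (sym x∼y) x∼rep))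
    where
    preserves : {σ : G → G} → T (preservesBlocks done σ) → Preserves lab σ
    preserves {σ} h z =
      let B , B∈ , Bz = find (any⁻ _ done (cov z))
          cB = All.lookup classes B∈
          Bσz : T (lookupᵗ (mask B) (σ z))
          Bσz = [ (λ ¬Bz → ⊥-elim (to T-not ¬Bz Bz)) , id ]
                  (to T-∨ (all-allG (λ g → not (lookupᵗ (mask B) g) ∨ lookupᵗ (mask B) (σ g))
                                    (All.lookup (all⁺ _ done h) B∈) z))
      in trans (to (mask⇔class cB) Bσz) (sym (to (mask⇔class cB) Bz))
    stabilizer-sound : {vw : Vec G 4 × Vec G 4} → vw ∈ stabilizerMatrices done → Stabilizer lab (linComb (proj₁ vw))
    stabilizer-sound {v , w} vw∈ =
      let inverse , pres = to T-∧
            (proj₂ (∈-filter⁻ (T? ∘ isStabilizerMatrix done) {xs = candidateMatrices done} vw∈))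
      in isAut-linComb {v} {w} (toWitness inverse) , preserves pres
    withinOrbit-sound : {xs : List G} {x y : G} → T (withinOrbit (stabilizerMatrices done) xs) →
                        x ∈ xs → y ∈ xs → ∃[ σ ] Stabilizer lab σ × σ x ≡ y
    withinOrbit-sound {r ∷ rs} ok x∈ y∈ =
      let σ , Sσ , σr≡x = reach x∈
          τ , Sτ , τr≡y = reach y∈
      in orbit-through Sσ Sτ σr≡x τr≡y
      where
      reach : {z : G} → z ∈ r ∷ rs → ∃[ σ ] Stabilizer lab σ × σ r ≡ z
      reach z∈ = let vw , vw∈ , hit = find (any⁻ _ _ (All.lookup (all⁺ _ _ ok) z∈))
                 in linComb (proj₁ vw) , stabilizer-sound vw∈ , toWitness hit

  search-sound : (n : ℕ) (done : List Block) (rem : List G) → Invariant done rem →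
                 search n done rem ≡ true → ClassesAreOrbits lab
  search-sound (suc n) done [] inv ok =
    leaf-sound class-blocks (λ g → all-covered g) (from T-≡ ok)
    where
    open Invariant inv
    all-covered : (g : G) → T (covered done g)
    all-covered g with T? (covered done g)
    ... | yes covered-g   = covered-g
    ... | no uncovered-g = ⊥-elim (¬Any[] (subst (g ∈_) (sym rem≡uncovered) (from (∈-uncovered⇔ {done}) uncovered-g)))
  search-sound (suc n) done (f ∷ rest) inv ok =
    search-sound n (toBlock m ∷ done) _ next
      ([ (λ incompatible → ⊥-elim (to T-not incompatible (compatible-sound (m-block ∷ class-blocks)))) , to T-≡ ]
         (to T-∨ (All.lookup (all⁺ _ _ (from T-≡ ok)) m∈candidates)))
    where
    open Step inv
    open Invariant inv

  singleton-block : (a : G) → ((g : G) → lab g ≡ lab a → g ≡ a) → IsClassBlock (toBlock (maskOf (a ∷ [])))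
  singleton-block a singleton = record
    { rep = a
    ; mask-class = λ g → T-injective (mk⇔
        (λ t → from (classOf-⇔ lab) (case (to (lookup-maskOf (a ∷ [])) t)))
        (λ Cg → from (lookup-maskOf (a ∷ [])) (here (singleton g (to (classOf-⇔ lab) Cg)))))
    ; members≡ = refl
    }
    where
    case : {g : G} → g ∈ a ∷ [] → lab g ≡ lab a
    case (here refl) = refl

  classes-are-orbits : ((g : G) → lab g ≡ lab E₃ → g ≡ E₃) → ClassesAreOrbits lab
  classes-are-orbits E₃-singleton = search-sound 20 initialBlocks (uncovered initialBlocks)
    (record { class-blocks = singleton-block E₃ E₃-singleton ∷ singleton-block e singleton-e ∷ []
            ; rem≡uncovered = refl
            ; e-covered = tt })
    searchOK

lemma8p5 : (lab : G → ℕ) → Is2SRing lab → Cyclotomic lab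
lemma8p5 lab S2 = cyclotomic (nontrivial-singleton lab schur)
  where
  schur = Is2SRing⇒IsRegular2Partition lab S2
  cyclotomic : ∃[ a ] a ≢ e × ((g : G) → lab g ≡ lab a → g ≡ a) → Cyclotomic lab
  cyclotomic (a , a≢e , a-singleton) =
    ClassesAreOrbits⇒Cyclotomic lab (ClassesAreOrbits-∘ φ-aut orbits)
    where
    φ = linComb (transporter a)
    φ-aut = transporter-isAut a≢e
    E₃-singleton : (g : G) → lab (φ g) ≡ lab (φ E₃) → g ≡ E₃
    E₃-singleton g φg∼φE₃ = aut-injective φ-aut
      (trans (a-singleton (φ g) (trans φg∼φE₃ (cong lab (transporter-E₃ a)))) (sym (transporter-E₃ a)))
    orbits : ClassesAreOrbits (lab ∘ φ)
    orbits = SearchSoundness.classes-are-orbits (lab ∘ φ) (IsRegular2Partition-∘ φ-aut schur) E₃-singleton
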